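{- Fix a deterministic path selection rule $\pi(s,t\mid G,H)$ and let $f(n,p)$ be its extremal function. Run the following procedure on an $n$-node directed graph $G$ with parameter $p$: set $H=(V,\emptyset)$; while there is a reachable pair $(s,t)$ in $G$ such that $\pi(s,t\mid G,H)$ has more than $f(n,p)/p$ edges not in $E(H)$, assign the path $\pi(s,t\mid G,H)$ to $(s,t)$ and add its edges to $H$; afterwards, assign to each remaining reachable pair $(s,t)$ with no assigned path the path $\pi(s,t\mid G,H)$ for the final $H$. Let $\pi(s,t)$ denote the path assigned to $(s,t)$. Then for every $n$-node directed graph $G$ and every sequence $P$ of $p$ demand pairs reachable in $G$, $$\left|\bigcup_{(s,t)\in P}E(\pi(s,t))\right|\le 2f(n,p).$$
   Context: A deterministic path selection rule takes a directed graph $G$, a subgraph $H\subseteq G$ and a pair $(s,t)$ with $t$ reachable from $s$ in $G$, and returns an $s\leadsto t$ path $\pi(s,t\mid G,H)$ in $G$. Its extremal function $f(n,p)$ is the maximum, over all $n$-node directed graphs $G$ and all sequences of $p$ reachable demand pairs, of $|E(H)|$ at the end of the process that starts with $H$ empty and, for each demand pair $(s,t)$ in turn, adds all edges of $\pi(s,t\mid G,H)$ to $H$. -}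

module Defs where

open import Data.Nat using (ℕ; zero; suc; _+_; _*_; _≤_; _<_)
open import Data.Bool using (Bool; true; false; _∧_; _∨_; not; if_then_else_)
open import Data.Fin using (Fin; _≟_)
open import Data.Fin.Base using ()
open import Data.List using (List; []; _∷_; map; allFin)
open import Data.Nat.ListAction using (sum)
open import Data.List.Relation.Unary.Unique.Propositional using (Unique)
open import Data.Vec using (Vec; toList)
open import Data.Vec.Relation.Unary.All using (All)
open import Data.Product using (_×_; _,_; ∃)
open import Data.Unit using (⊤)
open import Relation.Nullary.Decidable using (⌊_⌋)
open import Relation.Binary.PropositionalEquality using (_≡_)

Graph : ℕ → Set
Graph n = Fin n → Fin n → Bool

Pair : ℕ → Set
Pair n = Fin n × Fin n

module _ {n : ℕ} where

  _⊆ᴳ_ : Graph n → Graph n → Set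
  H ⊆ᴳ G = ∀ u v → H u v ≡ true → G u v ≡ true

  emptyG : Graph n
  emptyG _ _ = false

  _∪ᴳ_ : Graph n → Graph n → Graph n
  (A ∪ᴳ B) u v = A u v ∨ B u v

  _∖ᴳ_ : Graph n → Graph n → Graph n
  (A ∖ᴳ B) u v = A u v ∧ not (B u v)

  edgeCount : Graph n → ℕ
  edgeCount H = sum (map (λ u → sum (map (λ v → if H u v then 1 else 0) (allFin n))) (allFin n))

  data WalkList (G : Graph n) : Fin n → Fin n → List (Fin n) → Set where
    here : ∀ {s} → WalkList G s s (s ∷ [])
    step : ∀ {s u t vs} → G s u ≡ true → WalkList G u t vs → WalkList G s t (s ∷ vs)

  IsPath : Graph n → Fin n → Fin n → List (Fin n) → Set
  IsPath G s t vs = WalkList G s t vs × Unique vs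

  Reachable : Graph n → Fin n → Fin n → Set
  Reachable G s t = ∃ λ vs → IsPath G s t vs

  edgesOf : List (Fin n) → Graph n
  edgesOf [] u v = false
  edgesOf (x ∷ []) u v = false
  edgesOf (x ∷ y ∷ r) u v = (⌊ x ≟ u ⌋ ∧ ⌊ y ≟ v ⌋) ∨ edgesOf (y ∷ r) u v

  newEdges : List (Fin n) → Graph n → ℕ
  newEdges π H = edgeCount (edgesOf π ∖ᴳ H)

  pairEq : Pair n → Pair n → Bool
  pairEq (a , b) (s , t) = ⌊ a ≟ s ⌋ ∧ ⌊ b ≟ t ⌋

record PathRule : Set where
  field
    select : ∀ {n} → Graph n → Graph n → Fin n → Fin n → List (Fin n)
    valid  : ∀ {n} (G H : Graph n) (s t : Fin n) → H ⊆ᴳ G → Reachable G s t →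
             IsPath G s t (select G H s t)

open PathRule public

module _ (R : PathRule) {n : ℕ} (G : Graph n) where

  run : Graph n → List (Pair n) → Graph n
  run H [] = H
  run H ((s , t) ∷ ps) = run (H ∪ᴳ edgesOf (select R G H s t)) ps

  cost : ∀ {p} → Vec (Pair n) p → ℕ
  cost P = edgeCount (run emptyG (toList P))

  ReachablePair : Pair n → Set
  ReachablePair (s , t) = Reachable G s t

  -- a valid execution of the while-loop with parameter p and threshold f(n,p)/p,
  -- starting from the current H and picking the pairs in L in order:
  -- each picked pair is reachable and its path has more than f(n,p)/p new edges
  -- (written without division as  f(n,p) < (#new edges) * p )
  ValidLoop : ℕ → ℕ → Graph n → List (Pair n) → Set
  ValidLoop p fnp H [] = ⊤
  ValidLoop p fnp H ((s , t) ∷ L) =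
    Reachable G s t × fnp < newEdges (select R G H s t) H * p ×
    ValidLoop p fnp (H ∪ᴳ edgesOf (select R G H s t)) L

  Terminated : ℕ → ℕ → Graph n → Set
  Terminated p fnp H = ∀ s t → Reachable G s t → newEdges (select R G H s t) H * p ≤ fnp

  -- path assigned to (s,t) after the loop L (started from H) finishes:
  -- the path chosen at the last iteration that picked (s,t), or, if (s,t) was never
  -- picked, the default d = π(s,t | G, H_final)
  assignFrom : Graph n → List (Pair n) → Pair n → List (Fin n) → List (Fin n)
  assignFrom H [] q d = d
  assignFrom H ((a , b) ∷ L) q d =
    assignFrom (H ∪ᴳ edgesOf (select R G H a b)) L q
               (if pairEq (a , b) q then select R G H a b else d)

  assigned : List (Pair n) → Pair n → List (Fin n)
  assigned L (s , t) = assignFrom emptyG L (s , t) (select R G (run emptyG L) s t)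

  unionAssigned : ∀ {p} → List (Pair n) → Vec (Pair n) p → Graph n
  unionAssigned L P = go (toList P)
    where
      go : List (Pair n) → Graph n
      go [] = emptyG
      go (q ∷ qs) = edgesOf (assigned L q) ∪ᴳ go qs

-- f is the extremal function of R: f(n,p) is the maximum (least upper bound in ℕ,
-- which is 0 when there is no admissible instance) of |E(H)| over all n-node
-- digraphs G and all sequences of p reachable demand pairs.
IsExtremalFunction : PathRule → (ℕ → ℕ → ℕ) → Set
IsExtremalFunction R f = ∀ n p →
  (∀ (G : Graph n) (P : Vec (Pair n) p) → All (ReachablePair R G) P → cost R G P ≤ f n p) ×
  (∀ b → (∀ (G : Graph n) (P : Vec (Pair n) p) → All (ReachablePair R G) P → cost R G P ≤ b) →
     f n p ≤ b)

-- Let H be the graph when the loop stops. Each round of the loop adds more than f/p new edges,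
-- so there are fewer than p rounds: otherwise the first p chosen pairs would be a demand sequence
-- whose process builds more than f edges. Completing the chosen pairs to a sequence of p reachable
-- demands therefore gives |E(H)| ≤ f. Every assigned path lies in H plus the edges of π(s,t | G,H)
-- outside H, and after termination each of the p demand pairs contributes at most f/p of those,
-- so the union of the assigned paths has at most f + f edges.
module Submission where

open import Defs
open import Data.Nat using (ℕ; zero; suc; _+_; _*_; _≤_; z≤n)
open import Data.Nat.Properties
open import Data.Nat.ListAction using (sum)
open import Algebra.Properties.CommutativeSemigroup +-commutativeSemigroup using (interchange)
open import Data.Bool using (Bool; true; false; _∧_; _∨_; not; if_then_else_)
open import Data.Bool.Properties using (∨-zeroʳ; ∧-identityʳ)
open import Data.List using (List; []; _∷_; map; foldr; allFin; length)
open import Data.List.Properties using (foldr-universal; length-map)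
import Data.List.Relation.Unary.All as List
open import Data.List.Relation.Unary.All.Properties using (map⁺)
open import Data.Vec using (Vec; toList; []; _∷_)
open import Data.Vec.Properties using (length-toList)
open import Data.Vec.Relation.Unary.All using (All; []; _∷_)
open import Data.Vec.Relation.Unary.All.Properties using (toList⁺)
open import Data.Product using (_,_; proj₁)
open import Data.Sum using (_⊎_; inj₁; inj₂)
open import Data.Empty using (⊥-elim)
open import Function using (_∘_)
open import Relation.Binary.PropositionalEquality

count : Bool → ℕ
count b = if b then 1 else 0

count-mono : ∀ {a b} → (a ≡ true → b ≡ true) → count a ≤ count b
count-mono {false} _   = z≤n
count-mono {true}  a⇒b rewrite a⇒b refl = ≤-refl

count-∨ : ∀ a b → count (a ∨ b) ≡ count a + count (b ∧ not a)
count-∨ false false = refl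
count-∨ false true  = refl
count-∨ true  false = refl
count-∨ true  true  = refl

module _ {A : Set} where

  sum-map-mono : {f g : A → ℕ} → (∀ x → f x ≤ g x) → ∀ xs → sum (map f xs) ≤ sum (map g xs)
  sum-map-mono f≤g []       = z≤n
  sum-map-mono f≤g (x ∷ xs) = +-mono-≤ (f≤g x) (sum-map-mono f≤g xs)

  sum-map-cong : {f g : A → ℕ} → (∀ x → f x ≡ g x) → ∀ xs → sum (map f xs) ≡ sum (map g xs)
  sum-map-cong f≡g []       = refl
  sum-map-cong f≡g (x ∷ xs) = cong₂ _+_ (f≡g x) (sum-map-cong f≡g xs)

  sum-map-+ : (f g : A → ℕ) → ∀ xs →
              sum (map (λ x → f x + g x) xs) ≡ sum (map f xs) + sum (map g xs)
  sum-map-+ f g []       = refl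
  sum-map-+ f g (x ∷ xs) = begin
    f x + g x + sum (map (λ x → f x + g x) xs)     ≡⟨ cong (f x + g x +_) (sum-map-+ f g xs) ⟩
    f x + g x + (sum (map f xs) + sum (map g xs))  ≡⟨ interchange (f x) (g x) _ _ ⟩
    f x + sum (map f xs) + (g x + sum (map g xs))  ∎
    where open ≡-Reasoning

  sum-map-zero : ∀ xs → sum (map (λ (_ : A) → 0) xs) ≡ 0
  sum-map-zero []       = refl
  sum-map-zero (x ∷ xs) = sum-map-zero xs

sum-*-≤ : ∀ {p F} {xs : List ℕ} → List.All (λ x → x * p ≤ F) xs → sum xs * p ≤ length xs * F
sum-*-≤                 List.[]         = z≤n
sum-*-≤ {p} {F} {x ∷ xs} (x≤ List.∷ xs≤) = begin
  (x + sum xs) * p       ≡⟨ *-distribʳ-+ p x (sum xs) ⟩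
  x * p + sum xs * p     ≤⟨ +-mono-≤ x≤ (sum-*-≤ xs≤) ⟩
  F + length xs * F      ∎
  where open ≤-Reasoning

sum-≤-average : ∀ {p} F (xs : List ℕ) → length xs ≡ p →
                List.All (λ x → x * p ≤ F) xs → sum xs ≤ F
sum-≤-average     F []          _    _      = z≤n
sum-≤-average {p} F xs@(_ ∷ _) refl bounds = *-cancelʳ-≤ (sum xs) F p (begin
  sum xs * p  ≤⟨ sum-*-≤ bounds ⟩
  p * F       ≡⟨ *-comm p F ⟩
  F * p       ∎)
  where open ≤-Reasoning

module _ {n : ℕ} where

  ⊆ᴳ-refl : {A : Graph n} → A ⊆ᴳ A
  ⊆ᴳ-refl _ _ a = a

  ⊆ᴳ-trans : {A B C : Graph n} → A ⊆ᴳ B → B ⊆ᴳ C → A ⊆ᴳ C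
  ⊆ᴳ-trans A⊆B B⊆C u v a = B⊆C u v (A⊆B u v a)

  ∪ᴳ-⊆ˡ : {A B : Graph n} → A ⊆ᴳ (A ∪ᴳ B)
  ∪ᴳ-⊆ˡ {B = B} u v a = cong (_∨ B u v) a

  ∪ᴳ-⊆ʳ : {A B : Graph n} → B ⊆ᴳ (A ∪ᴳ B)
  ∪ᴳ-⊆ʳ {A = A} u v b = trans (cong (A u v ∨_) b) (∨-zeroʳ (A u v))

  ∪ᴳ-lub : {A B C : Graph n} → A ⊆ᴳ C → B ⊆ᴳ C → (A ∪ᴳ B) ⊆ᴳ C
  ∪ᴳ-lub {A} A⊆C B⊆C u v a∨b with A u v in a
  ... | true  = A⊆C u v a
  ... | false = B⊆C u v a∨b

  ∪ᴳ-monoʳ : {A B C : Graph n} → B ⊆ᴳ C → (A ∪ᴳ B) ⊆ᴳ (A ∪ᴳ C)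
  ∪ᴳ-monoʳ B⊆C = ∪ᴳ-lub ∪ᴳ-⊆ˡ (⊆ᴳ-trans B⊆C ∪ᴳ-⊆ʳ)

  ∖ᴳ-⊆ : {A B : Graph n} → (A ∖ᴳ B) ⊆ᴳ A
  ∖ᴳ-⊆ {A} u v a∧¬b with A u v
  ... | true  = refl
  ... | false = a∧¬b

  ∪ᴳ-⊆-∪ᴳ-∖ᴳ : {A B : Graph n} → (A ∪ᴳ B) ⊆ᴳ (A ∪ᴳ (B ∖ᴳ A))
  ∪ᴳ-⊆-∪ᴳ-∖ᴳ {A} {B} u v a∨b with A u v
  ... | true  = refl
  ... | false = trans (∧-identityʳ (B u v)) a∨b

  edgeCount-mono : {A B : Graph n} → A ⊆ᴳ B → edgeCount A ≤ edgeCount B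
  edgeCount-mono A⊆B =
    sum-map-mono (λ u → sum-map-mono (λ v → count-mono (A⊆B u v)) (allFin n)) (allFin n)

  edgeCount-∪ᴳ : (A B : Graph n) → edgeCount (A ∪ᴳ B) ≡ edgeCount A + edgeCount (B ∖ᴳ A)
  edgeCount-∪ᴳ A B = begin
    edgeCount (A ∪ᴳ B)
      ≡⟨ sum-map-cong (λ u → sum-map-cong (λ v → count-∨ (A u v) (B u v)) (allFin n)) (allFin n) ⟩
    sum (map (λ u → sum (map (λ v → count (A u v) + count ((B ∖ᴳ A) u v)) (allFin n))) (allFin n))
      ≡⟨ sum-map-cong (λ u → sum-map-+ (count ∘ A u) (count ∘ (B ∖ᴳ A) u) (allFin n)) (allFin n) ⟩
    sum (map (λ u → sum (map (count ∘ A u) (allFin n)) + sum (map (count ∘ (B ∖ᴳ A) u) (allFin n)))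
             (allFin n))
      ≡⟨ sum-map-+ _ _ (allFin n) ⟩
    edgeCount A + edgeCount (B ∖ᴳ A)
      ∎
    where open ≡-Reasoning

  edgeCount-∪ᴳ-≤ : (A B : Graph n) → edgeCount (A ∪ᴳ B) ≤ edgeCount A + edgeCount B
  edgeCount-∪ᴳ-≤ A B = begin
    edgeCount (A ∪ᴳ B)                ≡⟨ edgeCount-∪ᴳ A B ⟩
    edgeCount A + edgeCount (B ∖ᴳ A)  ≤⟨ +-monoʳ-≤ (edgeCount A) (edgeCount-mono ∖ᴳ-⊆) ⟩
    edgeCount A + edgeCount B         ∎
    where open ≤-Reasoning

  edgeCount-emptyG : edgeCount (emptyG {n}) ≡ 0
  edgeCount-emptyG = trans (sum-map-cong (λ _ → sum-map-zero (allFin n)) (allFin n))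
                           (sum-map-zero (allFin n))

  ⋃ᴳ : {A : Set} → (A → Graph n) → List A → Graph n
  ⋃ᴳ g = foldr (λ a → g a ∪ᴳ_) emptyG

  ⋃ᴳ-⊆ : {A : Set} {K : Graph n} {g h : A → Graph n} →
         (∀ a → g a ⊆ᴳ (K ∪ᴳ h a)) → ∀ as → ⋃ᴳ g as ⊆ᴳ (K ∪ᴳ ⋃ᴳ h as)
  ⋃ᴳ-⊆ g⊆ []       _ _ ()
  ⋃ᴳ-⊆ {K = K} {g} {h} g⊆ (a ∷ as) =
    ∪ᴳ-lub (⊆ᴳ-trans (g⊆ a) (∪ᴳ-monoʳ {K} (∪ᴳ-⊆ˡ {h a} {⋃ᴳ h as})))
           (⊆ᴳ-trans (⋃ᴳ-⊆ g⊆ as) (∪ᴳ-monoʳ {K} (∪ᴳ-⊆ʳ {h a} {⋃ᴳ h as})))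

  edgeCount-⋃ᴳ-≤ : {A : Set} (g : A → Graph n) → ∀ as →
                   edgeCount (⋃ᴳ g as) ≤ sum (map (edgeCount ∘ g) as)
  edgeCount-⋃ᴳ-≤ g []       = ≤-reflexive edgeCount-emptyG
  edgeCount-⋃ᴳ-≤ g (a ∷ as) =
    ≤-trans (edgeCount-∪ᴳ-≤ (g a) (⋃ᴳ g as)) (+-monoʳ-≤ (edgeCount (g a)) (edgeCount-⋃ᴳ-≤ g as))

overlay : {A : Set} {k : ℕ} → List A → Vec A k → Vec A k
overlay []       ys       = ys
overlay (_ ∷ _)  []       = []
overlay (x ∷ xs) (_ ∷ ys) = x ∷ overlay xs ys

All-overlay : {A : Set} {P : A → Set} {k : ℕ} {xs : List A} {ys : Vec A k} →
              List.All P xs → All P ys → All P (overlay xs ys)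
All-overlay List.[]           Pys        = Pys
All-overlay (_ List.∷ _)      []         = []
All-overlay (Px List.∷ Pxs)   (_ ∷ Pys)  = Px ∷ All-overlay Pxs Pys

module _ (R : PathRule) {n : ℕ} (G : Graph n) where

  run-⊇ : ∀ H L → H ⊆ᴳ run R G H L
  run-⊇ H []            = ⊆ᴳ-refl
  run-⊇ H (_ ∷ L)       = ⊆ᴳ-trans ∪ᴳ-⊆ˡ (run-⊇ _ L)

  ValidLoop⇒reachable : ∀ {p F H} L → ValidLoop R G p F H L → List.All (ReachablePair R G) L
  ValidLoop⇒reachable []            _                 = List.[]
  ValidLoop⇒reachable ((s , t) ∷ L) (reach , _ , loop) = reach List.∷ ValidLoop⇒reachable L loop

  module _ {p F : ℕ} where

    run-overlay-dichotomy : ∀ {k} H L (P : Vec (Pair n) k) → ValidLoop R G p F H L →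
        run R G H L ⊆ᴳ run R G H (toList (overlay L P))
      ⊎ edgeCount H * p + k * suc F ≤ edgeCount (run R G H (toList (overlay L P))) * p
    run-overlay-dichotomy H []            P       _  = inj₁ (run-⊇ H (toList P))
    run-overlay-dichotomy H (_ ∷ _)       []      _  = inj₂ (≤-reflexive (+-identityʳ _))
    run-overlay-dichotomy {suc k} H ((s , t) ∷ L) (_ ∷ P) (_ , gain , loop)
      with run-overlay-dichotomy (H ∪ᴳ edgesOf (select R G H s t)) L P loop
    ... | inj₁ ⊆run = inj₁ ⊆run
    ... | inj₂ ≤run = inj₂ (begin
      edgeCount H * p + (suc F + k * suc F)
        ≤⟨ +-monoʳ-≤ (edgeCount H * p) (+-monoˡ-≤ (k * suc F) gain) ⟩
      edgeCount H * p + (newEdges π H * p + k * suc F)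
        ≡⟨ +-assoc (edgeCount H * p) (newEdges π H * p) (k * suc F) ⟨
      edgeCount H * p + newEdges π H * p + k * suc F
        ≡⟨ cong (_+ k * suc F) (*-distribʳ-+ p (edgeCount H) (newEdges π H)) ⟨
      (edgeCount H + newEdges π H) * p + k * suc F
        ≡⟨ cong (λ e → e * p + k * suc F) (edgeCount-∪ᴳ H (edgesOf π)) ⟨
      edgeCount (H ∪ᴳ edgesOf π) * p + k * suc F
        ≤⟨ ≤run ⟩
      edgeCount (run R G (H ∪ᴳ edgesOf π) (toList (overlay L P))) * p
        ∎)
      where
      open ≤-Reasoning
      π = select R G H s t

  assignFrom-⊆ : ∀ {K} H L q d → run R G H L ⊆ᴳ K → edgesOf d ⊆ᴳ K →
                 edgesOf (assignFrom R G H L q d) ⊆ᴳ K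
  assignFrom-⊆     H []            q d _     d⊆K = d⊆K
  assignFrom-⊆ {K} H ((a , b) ∷ L) q d run⊆K d⊆K =
    assignFrom-⊆ (H ∪ᴳ edgesOf π) L q _ run⊆K (chosen⊆K (pairEq (a , b) q))
    where
    π = select R G H a b
    chosen⊆K : ∀ c → edgesOf (if c then π else d) ⊆ᴳ K
    chosen⊆K true  = ⊆ᴳ-trans (∪ᴳ-⊆ʳ {A = H}) (⊆ᴳ-trans (run-⊇ _ L) run⊆K)
    chosen⊆K false = d⊆K

  module _ (L : List (Pair n)) where

    finalGraph : Graph n
    finalGraph = run R G emptyG L

    finalGraph-edgeCount-≤ : ∀ {p F} → ValidLoop R G (suc p) F emptyG L →
      (∀ (Q : Vec (Pair n) (suc p)) → All (ReachablePair R G) Q → cost R G Q ≤ F) →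
      (P : Vec (Pair n) (suc p)) → All (ReachablePair R G) P →
      edgeCount finalGraph ≤ F
    finalGraph-edgeCount-≤ {p} {F} loop bounded P reach
      with run-overlay-dichotomy emptyG L P loop
         | bounded (overlay L P) (All-overlay (ValidLoop⇒reachable L loop) reach)
    ... | inj₁ ⊆run | Q≤F = ≤-trans (edgeCount-mono ⊆run) Q≤F
    ... | inj₂ ≤run | Q≤F = ⊥-elim (<-irrefl refl (begin-strict
      F * suc p                                       ≡⟨ *-comm F (suc p) ⟩
      suc p * F                                       <⟨ *-monoʳ-< (suc p) (n<1+n F) ⟩
      suc p * suc F                                   ≤⟨ m≤n+m _ (edgeCount (emptyG {n}) * suc p) ⟩
      edgeCount (emptyG {n}) * suc p + suc p * suc F  ≤⟨ ≤run ⟩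
      cost R G (overlay L P) * suc p                  ≤⟨ *-monoˡ-≤ (suc p) Q≤F ⟩
      F * suc p                                       ∎))
      where open ≤-Reasoning

    finalNewEdges : Pair n → Graph n
    finalNewEdges (s , t) = edgesOf (select R G finalGraph s t) ∖ᴳ finalGraph

    assigned-⊆ : ∀ q → edgesOf (assigned R G L q) ⊆ᴳ (finalGraph ∪ᴳ finalNewEdges q)
    assigned-⊆ (s , t) = assignFrom-⊆ emptyG L (s , t) _ ∪ᴳ-⊆ˡ
      (⊆ᴳ-trans (∪ᴳ-⊆ʳ {A = finalGraph}) (∪ᴳ-⊆-∪ᴳ-∖ᴳ {A = finalGraph}))

    unionAssigned-≡ : ∀ {p} (P : Vec (Pair n) p) →
                      unionAssigned R G L P ≡ ⋃ᴳ (edgesOf ∘ assigned R G L) (toList P)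
    -- unionAssigned folds over toList P with a local function that cannot be named here;
    -- abstracting toList P lets unification recover that function as the argument of foldr-universal.
    unionAssigned-≡ P with toList P | foldr-universal _ (λ q → edgesOf (assigned R G L q) ∪ᴳ_) emptyG
    ... | qs | universal = universal refl (λ _ _ → refl) qs

    unionAssigned-≤ : ∀ {p F} → Terminated R G p F finalGraph →
      (P : Vec (Pair n) p) → All (ReachablePair R G) P →
      edgeCount (unionAssigned R G L P) ≤ edgeCount finalGraph + F
    unionAssigned-≤ {p} {F} done P reach = begin
      edgeCount (unionAssigned R G L P)
        ≡⟨ cong edgeCount (unionAssigned-≡ P) ⟩
      edgeCount (⋃ᴳ (edgesOf ∘ assigned R G L) qs)
        ≤⟨ edgeCount-mono (⋃ᴳ-⊆ assigned-⊆ qs) ⟩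
      edgeCount (finalGraph ∪ᴳ ⋃ᴳ finalNewEdges qs)
        ≤⟨ edgeCount-∪ᴳ-≤ finalGraph (⋃ᴳ finalNewEdges qs) ⟩
      edgeCount finalGraph + edgeCount (⋃ᴳ finalNewEdges qs)
        ≤⟨ +-monoʳ-≤ (edgeCount finalGraph) (edgeCount-⋃ᴳ-≤ finalNewEdges qs) ⟩
      edgeCount finalGraph + sum (map (edgeCount ∘ finalNewEdges) qs)
        ≤⟨ +-monoʳ-≤ (edgeCount finalGraph) (sum-≤-average F _ length≡p (map⁺ small)) ⟩
      edgeCount finalGraph + F
        ∎
      where
      open ≤-Reasoning
      qs = toList P
      length≡p : length (map (edgeCount ∘ finalNewEdges) qs) ≡ p
      length≡p = trans (length-map _ qs) (length-toList P)
      finalNewEdges-small : ∀ q → ReachablePair R G q → edgeCount (finalNewEdges q) * p ≤ F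
      finalNewEdges-small (s , t) = done s t
      small : List.All (λ q → edgeCount (finalNewEdges q) * p ≤ F) qs
      small = List.map (λ {q} → finalNewEdges-small q) (toList⁺ reach)

theorem16 : (R : PathRule) (f : ℕ → ℕ → ℕ) → IsExtremalFunction R f →
    ∀ (n p : ℕ) (G : Graph n) (L : List (Pair n)) →
    ValidLoop R G p (f n p) emptyG L →
    Terminated R G p (f n p) (run R G emptyG L) →
    (P : Vec (Pair n) p) → All (ReachablePair R G) P →
    edgeCount (unionAssigned R G L P) ≤ 2 * f n p
theorem16 R f _        n zero    G L _    _    [] [] = ≤-trans (≤-reflexive (edgeCount-emptyG {n})) z≤n
theorem16 R f extremal n (suc p) G L loop done P reach = begin
  edgeCount (unionAssigned R G L P)
    ≤⟨ unionAssigned-≤ R G L done P reach ⟩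
  edgeCount (finalGraph R G L) + fnp
    ≤⟨ +-monoˡ-≤ fnp (finalGraph-edgeCount-≤ R G L loop extremal-bound P reach) ⟩
  fnp + fnp
    ≡⟨ cong (fnp +_) (+-identityʳ fnp) ⟨
  2 * fnp
    ∎
  where
  open ≤-Reasoning
  fnp = f n (suc p)
  extremal-bound = proj₁ (extremal n (suc p)) G
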